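{- Let a conjunctive Boolean control network (CBCN) be given in which no state-variable that is not directly controlled has a constant update function, and suppose its dependency graph $G$ is a directed acyclic graph and the CBCN has Property P (every simple node of $G$ has, among its in-neighbors, either a generator or a channel). Then the vertex set of $G$ can be partitioned into pairwise disjoint controlled paths, i.e. there is a family of controlled paths such that every vertex of $G$ belongs to exactly one of them.
   Context: A CBCN with $n$ Boolean state-variables and control index set $\mathcal{I}\subseteq\{1,\dots,n\}$ evolves by $X_i(k+1)=U_i(k)$ for $i\in\mathcal{I}$ and $X_i(k+1)=\prod_{j=1}^n (X_j(k))^{\epsilon_{ji}}$ for $i\notin\mathcal{I}$, where $\epsilon_{ji}\in\{0,1\}$, products denote AND, $x^0=1$; a state-variable $i\notin\mathcal{I}$ has a constant update function if $\epsilon_{ji}=0$ for all $j$. Its dependency graph is the digraph with a vertex for each state-variable (a simple node) and a vertex for each control input $U_i$, $i\in\mathcal{I}$ (a generator), with an arc $j\to i$ whenever $i\notin\mathcal{I}$ and $\epsilon_{ji}=1$, and an arc $U_i\to i$ for each $i\in\mathcal{I}$. A channel is a simple node with out-degree exactly one and without a self-loop. A controlled path is a nonempty ordered sequence of vertices $(w_1,\dots,w_m)$ of the dependency graph such that $w_1$ is a generator and, for each $i\in\{2,\dots,m\}$, $w_i$ is a simple node and is the only out-neighbor of $w_{i-1}$. -}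

module Defs where

open import Data.Nat using (ℕ)
open import Data.Fin using (Fin)
open import Data.Bool using (Bool; true; false; T)
open import Data.List using (List; []; _∷_)
open import Data.List.Membership.Propositional using (_∈_)
open import Data.List.Relation.Unary.Linked using (Linked)
open import Data.Product using (Σ; ∃; _×_)
open import Data.Sum using (_⊎_)
open import Data.Empty using (⊥)
open import Relation.Nullary using (¬_)
open import Relation.Binary.PropositionalEquality using (_≡_)
open import Relation.Binary.Construct.Closure.Transitive using (TransClosure)

-- A conjunctive Boolean control network with n state-variables.
--   ctrl i = true   iff  i ∈ 𝓘  (i is directly controlled)
--   eps j i         is  ε_{ji}
-- The dynamics X_i(k+1) = U_i(k) (i ∈ 𝓘), X_i(k+1) = ∏_j X_j(k)^{ε_ji} (i ∉ 𝓘)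
-- is determined entirely by these data.
record CBCN : Set where
  field
    n    : ℕ
    ctrl : Fin n → Bool
    eps  : Fin n → Fin n → Bool

module _ (N : CBCN) where
  open CBCN N

  NoConstantUpdate : Set
  NoConstantUpdate = ∀ i → ctrl i ≡ false → ∃ λ j → eps j i ≡ true

  data Vertex : Set where
    simple : Fin n → Vertex
    gen    : (i : Fin n) → T (ctrl i) → Vertex

  Arc : Vertex → Vertex → Set
  Arc (simple j) (simple i) = (ctrl i ≡ false) × (eps j i ≡ true)
  Arc (gen i _)  (simple k) = i ≡ k
  Arc _          (gen _ _)  = ⊥

  IsSimple : Vertex → Set
  IsSimple (simple _) = Data.Unit.⊤ where import Data.Unit
  IsSimple (gen _ _)  = ⊥

  IsGenerator : Vertex → Set
  IsGenerator (simple _) = ⊥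
  IsGenerator (gen _ _)  = Data.Unit.⊤ where import Data.Unit

  OnlyOutNeighbour : Vertex → Vertex → Set
  OnlyOutNeighbour v w = Arc v w × (∀ u → Arc v u → u ≡ w)

  IsChannel : Vertex → Set
  IsChannel v = IsSimple v × (∃ λ w → OnlyOutNeighbour v w) × ¬ Arc v v

  IsDAG : Set
  IsDAG = ∀ v → ¬ TransClosure Arc v v

  PropertyP : Set
  PropertyP = ∀ v → IsSimple v →
    ∃ λ u → Arc u v × (IsGenerator u ⊎ IsChannel u)

  PathStep : Vertex → Vertex → Set
  PathStep v w = IsSimple w × OnlyOutNeighbour v w

  ControlledPath : List Vertex → Set
  ControlledPath []       = ⊥
  ControlledPath (w ∷ ws) = IsGenerator w × Linked PathStep (w ∷ ws)

  PartitionIntoControlledPaths : Set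
  PartitionIntoControlledPaths =
    Σ ℕ λ m → Σ (Fin m → List Vertex) λ P →
      (∀ k → ControlledPath (P k)) ×
      (∀ v → Σ (Fin m) λ k → (v ∈ P k) × (∀ k′ → v ∈ P k′ → k′ ≡ k))

module Submission where

-- By Property P every simple node i has an in-neighbour which is
-- a generator or a channel; call it the parent of i.  In both cases i is the
-- ONLY out-neighbour of its parent, so "parent, i" is a legal step of a
-- controlled path, and distinct simple nodes have distinct parents.  Extend
-- the parent map to generators by the identity.  Iterating it n times from a
-- vertex v lands on a generator, the root of v: otherwise v and its first n
-- ancestors are n + 1 simple nodes with only n names, so two coincide
-- (pigeonhole) and the arcs between them form a cycle, contradicting
-- acyclicity.  As parents are injective every vertex has at most one child;
-- following children from a generator g gives a controlled path, the chain of
-- g, and v lies in the chain of g exactly when g is the root of v.  Hence the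
-- chains of all generators partition the vertex set.

open import Defs
open import Data.Nat using (ℕ; zero; suc; _+_; _∸_; _≤_; _<_; s≤s)
open import Data.Nat.Properties
  using (≤-refl; ≤-trans; ≤-total; ≤-pred; <⇒≤; n<1+n; m<n⇒m<1+n; m≤n⇒m≤1+n; m≤n⇒m<n∨m≡n; m∸n+n≡m)
open import Data.Fin using (Fin; toℕ)
open import Data.Fin.Properties using (any?; pigeonhole; toℕ≤pred[n]) renaming (_≟_ to _≟ᶠ_)
open import Data.Bool using (T)
open import Data.Bool.Properties using (T?; T-irrelevant)
open import Data.Unit using (tt)
open import Data.List using (List; []; _∷_; length; lookup; allFin)
open import Data.List.Membership.Propositional using (_∈_)
open import Data.List.Membership.Propositional.Properties using (∈-lookup; ∈-allFin)
open import Data.List.Relation.Unary.Any as Any using (here; there)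
open import Data.List.Relation.Unary.Any.Properties using (lookup-index)
open import Data.List.Relation.Unary.All as All using ()
open import Data.List.Relation.Unary.AllPairs using ([]; _∷_)
open import Data.List.Relation.Unary.Unique.Propositional using (Unique)
open import Data.List.Relation.Unary.Unique.Propositional.Properties using (allFin⁺)
open import Data.List.Relation.Unary.Linked using (Linked; [-]; _∷_)
open import Data.Product using (Σ; ∃; _×_; _,_; proj₁; proj₂; map₂)
open import Data.Sum using (_⊎_; inj₁; inj₂)
open import Data.Empty using (⊥; ⊥-elim)
open import Relation.Nullary using (Dec; yes; no)
open import Relation.Binary.PropositionalEquality using (_≡_; refl; sym; trans; cong; subst)
open import Relation.Binary.Construct.Closure.Transitive using (TransClosure; [_]; _∷_)

module Walks {A : Set} (R : A → A → Set) (x : ℕ → A) where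

  backward-walk : ∀ i j → i < j → (∀ e → e < j → R (x (suc e)) (x e)) →
                  TransClosure R (x j) (x i)
  backward-walk i (suc j) i<1+j step with m≤n⇒m<n∨m≡n (≤-pred i<1+j)
  ... | inj₁ i<j  = step j (n<1+n j) ∷ backward-walk i j i<j (λ e e<j → step e (m<n⇒m<1+n e<j))
  ... | inj₂ refl = [ step j (n<1+n j) ]

  walk-closes-cycle : ∀ {n} (label : A → Fin n) →
    (∀ i j → i ≤ n → j ≤ n → label (x i) ≡ label (x j) → x i ≡ x j) →
    (∀ e → e < n → R (x (suc e)) (x e)) → ∃ λ a → TransClosure R a a
  walk-closes-cycle {n} label separates step
    with pigeonhole (n<1+n n) (λ e → label (x (toℕ e)))
  ... | i , j , i<j , same-label =
    x (toℕ i) , subst (λ a → TransClosure R a (x (toℕ i))) (sym same) walk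
    where
      j≤n : toℕ j ≤ n
      j≤n = toℕ≤pred[n] j
      same : x (toℕ i) ≡ x (toℕ j)
      same = separates (toℕ i) (toℕ j) (toℕ≤pred[n] i) j≤n same-label
      walk : TransClosure R (x (toℕ j)) (x (toℕ i))
      walk = backward-walk (toℕ i) (toℕ j) i<j (λ e e<j → step e (≤-trans e<j j≤n))

lookup-injective : ∀ {K : Set} {ks : List K} → Unique ks →
                   ∀ {i j} → lookup ks i ≡ lookup ks j → i ≡ j
lookup-injective {ks = _ ∷ _} (_ ∷ _) {Fin.zero} {Fin.zero} _ = refl
lookup-injective {ks = _ ∷ _} (fresh ∷ _) {Fin.zero} {Fin.suc j} same =
  ⊥-elim (All.lookup fresh (∈-lookup j) same)
lookup-injective {ks = _ ∷ _} (fresh ∷ _) {Fin.suc i} {Fin.zero} same =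
  ⊥-elim (All.lookup fresh (∈-lookup i) (sym same))
lookup-injective {ks = _ ∷ _} (_ ∷ distinct) {Fin.suc i} {Fin.suc j} same =
  cong Fin.suc (lookup-injective distinct same)

reindex-partition : ∀ {K A : Set} (ks : List K) → Unique ks → (Q : K → List A) (κ : A → K) →
  (∀ a → κ a ∈ ks) → (∀ a → a ∈ Q (κ a)) → (∀ a k → k ∈ ks → a ∈ Q k → k ≡ κ a) →
  ∀ a → Σ (Fin (length ks)) λ i → a ∈ Q (lookup ks i) × (∀ i′ → a ∈ Q (lookup ks i′) → i′ ≡ i)
reindex-partition ks distinct Q κ listed covers only a =
  Any.index (listed a) , subst (λ k → a ∈ Q k) at-key (covers a) ,
  λ i′ a∈ → lookup-injective distinct (trans (only a _ (∈-lookup i′) a∈) at-key)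
  where
    at-key : κ a ≡ lookup ks (Any.index (listed a))
    at-key = lookup-index (listed a)

module DependencyForest (N : CBCN) (acyclic : IsDAG N) (property-P : PropertyP N) where
  open CBCN N

  V : Set
  V = Vertex N

  _≟_ : (v w : V) → Dec (v ≡ w)
  simple i ≟ simple j with i ≟ᶠ j
  ... | yes refl = yes refl
  ... | no i≢j   = no λ { refl → i≢j refl }
  simple _ ≟ gen _ _ = no λ ()
  gen _ _ ≟ simple _ = no λ ()
  gen i t ≟ gen j u with i ≟ᶠ j
  ... | yes refl = yes (cong (gen i) (T-irrelevant t u))
  ... | no i≢j   = no λ { refl → i≢j refl }

  index : V → Fin n
  index (simple i) = i
  index (gen i _)  = i

  index-injective : ∀ {v w} → IsSimple N v → IsSimple N w → index v ≡ index w → v ≡ w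
  index-injective {simple _} {simple _} _ _ = cong simple

  kind : (w : V) → IsSimple N w ⊎ IsGenerator N w
  kind (simple _) = inj₁ tt
  kind (gen _ _)  = inj₂ tt

  not-both : ∀ {w} → IsSimple N w → IsGenerator N w → ⊥
  not-both {simple _} _ ()

  parent : Fin n → V
  parent i = proj₁ (property-P (simple i) tt)

  parent-only : ∀ i → OnlyOutNeighbour N (parent i) (simple i)
  parent-only i with property-P (simple i) tt
  ... | gen g _ , g≡i , _ = g≡i , λ { (simple k) g≡k → cong simple (trans (sym g≡k) g≡i)
                                      ; (gen _ _) () }
  ... | simple j , j→i , inj₂ (_ , (_ , _ , only-w) , _) =
    j→i , λ u j→u → trans (only-w u j→u) (sym (only-w (simple i) j→i))
  ... | simple _ , _ , inj₁ ()

  parent-step : ∀ i → PathStep N (parent i) (simple i)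
  parent-step i = tt , parent-only i

  parent-injective : ∀ {i j} → parent i ≡ parent j → i ≡ j
  parent-injective {i} {j} same with proj₂ (parent-only j) (simple i)
                                       (subst (λ p → Arc N p (simple i)) same (proj₁ (parent-only i)))
  ... | refl = refl

  up : V → V
  up (simple i) = parent i
  up (gen i t)  = gen i t

  up-arc : ∀ w → IsSimple N w → Arc N (up w) w
  up-arc (simple i) _ = proj₁ (parent-only i)

  ancestor : ℕ → V → V
  ancestor zero    v = v
  ancestor (suc j) v = up (ancestor j v)

  ancestor-stable : ∀ {i j v} → IsGenerator N (ancestor i v) → i ≤ j → ancestor j v ≡ ancestor i v
  ancestor-stable {i} {j} {v} g i≤j =
    trans (cong (λ k → ancestor k v) (sym (m∸n+n≡m i≤j))) (stays (j ∸ i))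
    where
      stays : ∀ k → ancestor (k + i) v ≡ ancestor i v
      stays zero    = refl
      stays (suc k) = trans (cong up (stays k)) (fixed (ancestor i v) g)
        where
          fixed : ∀ w → IsGenerator N w → up w ≡ w
          fixed (gen _ _) _ = refl

  root : V → V
  root v = ancestor n v

  -- By acyclicity the root is a generator: if it were simple, so would be all
  -- ancestors up to depth n, and they would form a backward walk with n
  -- names for n + 1 points.
  root-is-generator : ∀ v → IsGenerator N (root v)
  root-is-generator v with kind (root v)
  ... | inj₂ g = g
  ... | inj₁ s with Walks.walk-closes-cycle (Arc N) (λ e → ancestor e v) index separates
                      (λ e e<n → up-arc _ (simple-at e (<⇒≤ e<n)))
    where
      simple-at : ∀ e → e ≤ n → IsSimple N (ancestor e v)
      simple-at e e≤n with kind (ancestor e v)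
      ... | inj₁ s-e = s-e
      ... | inj₂ g   = ⊥-elim (not-both (subst (IsSimple N) (ancestor-stable g e≤n) s) g)
      separates : ∀ i j → i ≤ n → j ≤ n → index (ancestor i v) ≡ index (ancestor j v) →
                  ancestor i v ≡ ancestor j v
      separates i j i≤n j≤n = index-injective (simple-at i i≤n) (simple-at j j≤n)
  ... | a , a→a = ⊥-elim (acyclic a a→a)

  generator-ancestor-is-root : ∀ {j v} → IsGenerator N (ancestor j v) → ancestor j v ≡ root v
  generator-ancestor-is-root {j} {v} g with ≤-total j n
  ... | inj₁ j≤n = sym (ancestor-stable g j≤n)
  ... | inj₂ n≤j = ancestor-stable (root-is-generator v) n≤j

  -- w has a child when it is the parent of a simple node; by injectivity of
  -- parents that child is unique.
  HasChild : V → Set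
  HasChild w = ∃ λ i → parent i ≡ w

  has-child? : ∀ w → Dec (HasChild w)
  has-child? w = any? (λ i → parent i ≟ w)

  mutual
    chain : ℕ → V → List V
    chain f w = w ∷ descendants f w

    descendants : ℕ → V → List V
    descendants zero    w = []
    descendants (suc f) w with has-child? w
    ... | yes (i , _) = chain f (simple i)
    ... | no _        = []

  chain-linked : ∀ f w → Linked (PathStep N) (chain f w)
  chain-linked zero    w = [-]
  chain-linked (suc f) w with has-child? w
  ... | yes (i , refl) = parent-step i ∷ chain-linked f (simple i)
  ... | no _           = [-]

  chain-controlled : ∀ f {w} → IsGenerator N w → ControlledPath N (chain f w)
  chain-controlled f {w} g = g , chain-linked f w

  chain-ancestor : ∀ f w {v} → v ∈ chain f w → ∃ λ j → ancestor j v ≡ w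
  chain-ancestor f w (here refl) = 0 , refl
  chain-ancestor (suc f) w (there v∈) with has-child? w
  ... | yes (i , refl) with chain-ancestor f (simple i) v∈
  ...   | j , at-child = suc j , cong up at-child

  chain-of-parent : ∀ f i → chain (suc f) (parent i) ≡ parent i ∷ chain f (simple i)
  chain-of-parent f i with has-child? (parent i)
  ... | yes (j , same) = cong (λ k → parent i ∷ chain f (simple k)) (parent-injective same)
  ... | no childless   = ⊥-elim (childless (i , refl))

  -- v lies in the chain of each ancestor whose depth the fuel covers: a simple
  -- ancestor hands v one generation up to its parent, a generator is its own parent.
  in-ancestor-chain : ∀ v e f → e ≤ f → v ∈ chain f (ancestor e v)
  in-ancestor-chain v zero    f       _         = here refl
  in-ancestor-chain v (suc e) (suc f) (s≤s e≤f) =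
    climb (ancestor e v) (in-ancestor-chain v e f e≤f)
          (in-ancestor-chain v e (suc f) (m≤n⇒m≤1+n e≤f))
    where
      climb : ∀ w → v ∈ chain f w → v ∈ chain (suc f) w → v ∈ chain (suc f) (up w)
      climb (simple i) v∈ _ = subst (v ∈_) (sym (chain-of-parent f i)) (there v∈)
      climb (gen _ _)  _ v∈ = v∈

  in-root-chain : ∀ v → v ∈ chain n (root v)
  in-root-chain v = in-ancestor-chain v n n ≤-refl

  root-chain-unique : ∀ {g v} → IsGenerator N g → v ∈ chain n g → g ≡ root v
  root-chain-unique {g} {v} g-gen v∈ with chain-ancestor n g v∈
  ... | j , refl = generator-ancestor-is-root {j} {v} g-gen

  generatorsAmong : List (Fin n) → List V
  generatorsAmong []       = []
  generatorsAmong (i ∷ is) with T? (ctrl i)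
  ... | yes t = gen i t ∷ generatorsAmong is
  ... | no _  = generatorsAmong is

  generatorsAmong-sound : ∀ is {w} → w ∈ generatorsAmong is → IsGenerator N w × index w ∈ is
  generatorsAmong-sound (i ∷ is) w∈ with T? (ctrl i)
  generatorsAmong-sound (i ∷ is) (here refl) | yes _ = tt , here refl
  generatorsAmong-sound (i ∷ is) (there w∈)  | yes _ = map₂ there (generatorsAmong-sound is w∈)
  generatorsAmong-sound (i ∷ is) w∈          | no _  = map₂ there (generatorsAmong-sound is w∈)

  generatorsAmong-complete : ∀ {is i} (t : T (ctrl i)) → i ∈ is → gen i t ∈ generatorsAmong is
  generatorsAmong-complete {i ∷ _} t (here refl) with T? (ctrl i)
  ... | yes t′ = here (cong (gen i) (T-irrelevant t t′))
  ... | no ¬t  = ⊥-elim (¬t t)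
  generatorsAmong-complete {j ∷ _} t (there i∈) with T? (ctrl j)
  ... | yes _ = there (generatorsAmong-complete t i∈)
  ... | no _  = generatorsAmong-complete t i∈

  generatorsAmong-unique : ∀ {is} → Unique is → Unique (generatorsAmong is)
  generatorsAmong-unique {[]}     _                = []
  generatorsAmong-unique {i ∷ is} (i-fresh ∷ rest) with T? (ctrl i)
  ... | yes _ = All.tabulate (λ w∈ same → All.lookup i-fresh (proj₂ (generatorsAmong-sound is w∈)) (cong index same))
              ∷ generatorsAmong-unique rest
  ... | no _  = generatorsAmong-unique rest

  generators : List V
  generators = generatorsAmong (allFin n)

  ∈-generators : ∀ {w} → IsGenerator N w → w ∈ generators
  ∈-generators {gen i t} _ = generatorsAmong-complete t (∈-allFin i)

proposition3 : (N : CBCN) → NoConstantUpdate N → IsDAG N → PropertyP N →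
    PartitionIntoControlledPaths N
proposition3 N _ acyclic property-P =
  length generators , (λ k → chain n (lookup generators k)) ,
  (λ k → chain-controlled n (proj₁ (generatorsAmong-sound (allFin n) (∈-lookup k)))) ,
  reindex-partition generators (generatorsAmong-unique (allFin⁺ n)) (chain n) root
    (λ v → ∈-generators (root-is-generator v))
    in-root-chain
    (λ v g g∈ v∈ → root-chain-unique (proj₁ (generatorsAmong-sound (allFin n) g∈)) v∈)
  where
    open CBCN N using (n)
    open DependencyForest N acyclic property-P
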